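{- The solutions in positive integers $(m,l,k)$ of the equation $$2=\frac{m}{m+1}+\frac{(l-k)(k+1)}{l+1}$$ are exactly $(1,5,2)$, $(1,7,1)$, $(1,7,5)$, $(2,5,1)$, $(2,5,3)$, $(4,4,1)$ and $(4,4,2)$. -}

module Defs where

open import Data.Nat using (ℕ; suc)
open import Data.Integer using (ℤ; +_) renaming (_-_ to _-ℤ_; _*_ to _*ℤ_)
open import Data.Rational using (ℚ; _/_; _+_)

-- The right-hand side  m/(m+1) + (l-k)(k+1)/(l+1)  as a rational number,
-- with l - k computed in ℤ (it may be negative).
rhs : ℕ → ℕ → ℕ → ℚ
rhs m l k = (+ m) / suc m + ((+ l -ℤ + k) *ℤ (+ suc k)) / suc l

-- Clearing denominators turns the equation into
--   (m+2)(l+1) + k(k+1)(m+1) = l(k+1)(m+1),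
-- which forces l = k + a with a(k+1)(m+1) = (m+2)(k+a+1).  Writing x = a(k+1) and
-- y = k+a+1, the equation (m+2)y = x(m+1) gives y < x, m+1 ≤ y and, since m ≥ 1,
-- 2x ≤ 3y.  The last inequality bounds a + k ≤ 7, hence m ≤ 7, and the remaining
-- finitely many triples are checked by evaluation.
module Submission where

open import Defs
open import Data.Nat using (ℕ; _≥_)
open import Data.Product using (_×_; _,_)
open import Data.Sum using (_⊎_; inj₁; inj₂)
open import Relation.Binary.PropositionalEquality using (_≡_; refl)

Solution : ℕ → ℕ → ℕ → Set
Solution m l k =
  (m ≡ 1 × l ≡ 5 × k ≡ 2) ⊎ (m ≡ 1 × l ≡ 7 × k ≡ 1) ⊎ (m ≡ 1 × l ≡ 7 × k ≡ 5)
  ⊎ (m ≡ 2 × l ≡ 5 × k ≡ 1) ⊎ (m ≡ 2 × l ≡ 5 × k ≡ 3) ⊎ (m ≡ 4 × l ≡ 4 × k ≡ 1)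
  ⊎ (m ≡ 4 × l ≡ 4 × k ≡ 2)

module ClearDenominators where
  open import Data.Nat as ℕ using (suc)
  open import Data.Integer using (+_; _+_; _-_; _*_)
  open import Data.Integer.Properties using (+-injective; pos-*)
  open import Data.Integer.Tactic.RingSolver
  open import Data.List using ([]; _∷_)
  open import Data.Rational as ℚ using (1ℚ; _/_)
  open import Data.Rational.Properties using (toℚᵘ-cong; toℚᵘ-homo-+; toℚᵘ-fromℚᵘ)
  open import Data.Rational.Unnormalised using (mkℚᵘ; *≡*)
  open import Data.Rational.Unnormalised.Properties using (≃-trans; +-cong)
  open import Relation.Binary.PropositionalEquality

  cross-multiplied : ∀ m l k → 1ℚ ℚ.+ 1ℚ ≡ rhs m l k →
    + 2 * ((+ 1 + + m) * (+ 1 + + l)) ≡ (+ m * (+ 1 + + l) + (+ l - + k) * (+ 1 + + k) * (+ 1 + + m)) * + 1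
  cross-multiplied m l k h
    with *≡* e ← ≃-trans (toℚᵘ-cong h)
                   (≃-trans (toℚᵘ-homo-+ (+ m / suc m) (((+ l - + k) * + suc k) / suc l))
                     (+-cong (toℚᵘ-fromℚᵘ (mkℚᵘ (+ m) m))
                             (toℚᵘ-fromℚᵘ (mkℚᵘ ((+ l - + k) * + suc k) l))))
    = e

  integer-equation : ∀ M L K → + 2 * ((+ 1 + M) * (+ 1 + L)) ≡ (M * (+ 1 + L) + (L - K) * (+ 1 + K) * (+ 1 + M)) * + 1 →
    (+ 2 + M) * (+ 1 + L) + K * (+ 1 + K) * (+ 1 + M) ≡ L * (+ 1 + K) * (+ 1 + M)
  integer-equation M L K e = begin
    (+ 2 + M) * (+ 1 + L) + K * (+ 1 + K) * (+ 1 + M)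
      ≡⟨ solve (M ∷ L ∷ K ∷ []) ⟩
    + 2 * ((+ 1 + M) * (+ 1 + L)) - M * (+ 1 + L) + K * (+ 1 + K) * (+ 1 + M)
      ≡⟨ cong (λ t → t - M * (+ 1 + L) + K * (+ 1 + K) * (+ 1 + M)) e ⟩
    (M * (+ 1 + L) + (L - K) * (+ 1 + K) * (+ 1 + M)) * + 1 - M * (+ 1 + L) + K * (+ 1 + K) * (+ 1 + M)
      ≡⟨ solve (M ∷ L ∷ K ∷ []) ⟩
    L * (+ 1 + K) * (+ 1 + M) ∎
    where open ≡-Reasoning

  pos-*-* : ∀ a b c → + (a ℕ.* b ℕ.* c) ≡ + a * + b * + c
  pos-*-* a b c = trans (pos-* (a ℕ.* b) c) (cong (_* + c) (pos-* a b))

  cleared : ∀ m l k → 1ℚ ℚ.+ 1ℚ ≡ rhs m l k →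
    (2 ℕ.+ m) ℕ.* suc l ℕ.+ k ℕ.* suc k ℕ.* suc m ≡ l ℕ.* suc k ℕ.* suc m
  cleared m l k h = +-injective (begin
    + ((2 ℕ.+ m) ℕ.* suc l ℕ.+ k ℕ.* suc k ℕ.* suc m)
      ≡⟨ cong₂ _+_ (pos-* (2 ℕ.+ m) (suc l)) (pos-*-* k (suc k) (suc m)) ⟩
    (+ 2 + + m) * (+ 1 + + l) + + k * (+ 1 + + k) * (+ 1 + + m)
      ≡⟨ integer-equation (+ m) (+ l) (+ k) (cross-multiplied m l k h) ⟩
    + l * (+ 1 + + k) * (+ 1 + + m)
      ≡⟨ pos-*-* l (suc k) (suc m) ⟨
    + (l ℕ.* suc k ℕ.* suc m) ∎)
    where open ≡-Reasoning

module ClearedEquation where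
  open import Data.Nat
  open import Data.Nat.Properties
  open import Data.Nat.Tactic.RingSolver
  open import Data.List using ([]; _∷_)
  open import Relation.Binary.PropositionalEquality
  open import Relation.Nullary using (contradiction)
  open import Relation.Nullary.Decidable using (Dec; toWitness; _×-dec_; _⊎-dec_; _→-dec_)

  module Proportion {m x y : ℕ} (eq : (2 + m) * y ≡ x * suc m) where

    y<x : .{{NonZero y}} → y < x
    y<x = *-cancelʳ-< (suc m) y x (begin-strict
      y * suc m     ≡⟨ *-comm y (suc m) ⟩
      suc m * y     <⟨ m<n+m (suc m * y) (>-nonZero⁻¹ y) ⟩
      (2 + m) * y   ≡⟨ eq ⟩
      x * suc m     ∎)
      where open ≤-Reasoning

    1+m≤y : .{{NonZero y}} → suc m ≤ y
    1+m≤y = +-cancelʳ-≤ (suc m * y) (suc m) y (begin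
      suc m + suc m * y  ≡⟨ *-suc (suc m) y ⟨
      suc m * suc y      ≤⟨ *-monoʳ-≤ (suc m) y<x ⟩
      suc m * x          ≡⟨ *-comm (suc m) x ⟩
      x * suc m          ≡⟨ eq ⟨
      y + suc m * y      ∎)
      where open ≤-Reasoning

    2x≤3y : 1 ≤ m → 2 * x ≤ 3 * y
    2x≤3y 1≤m = *-cancelʳ-≤ (2 * x) (3 * y) (suc m) (begin
      2 * x * suc m        ≡⟨ *-assoc 2 x (suc m) ⟩
      2 * (x * suc m)      ≡⟨ cong (2 *_) eq ⟨
      2 * ((2 + m) * y)    ≡⟨ *-assoc 2 (2 + m) y ⟨
      2 * (2 + m) * y      ≤⟨ *-monoˡ-≤ y (2*[2+n]≤3*[1+n] 1≤m) ⟩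
      3 * suc m * y        ≡⟨ solve (m ∷ y ∷ []) ⟩
      3 * y * suc m        ∎)
      where
      open ≤-Reasoning
      2*[2+n]≤3*[1+n] : ∀ {n} → 1 ≤ n → 2 * (2 + n) ≤ 3 * suc n
      2*[2+n]≤3*[1+n] {suc n} _ = begin
        2 * (2 + suc n)   ≡⟨ solve (n ∷ []) ⟩
        6 + 2 * n         ≤⟨ m≤m+n (6 + 2 * n) n ⟩
        6 + 2 * n + n     ≡⟨ solve (n ∷ []) ⟩
        3 * suc (suc n)   ∎

  a+k≤7 : ∀ a k → suc (k + a) < a * suc k → 2 * (a * suc k) ≤ 3 * suc (k + a) → a + k ≤ 7
  a+k≤7 zero k () _
  a+k≤7 1 k 2+k<1+k _ = contradiction (begin-strict
    suc k        <⟨ n<1+n (suc k) ⟩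
    suc (suc k)  ≡⟨ cong suc (+-comm 1 k) ⟩
    suc (k + 1)  <⟨ 2+k<1+k ⟩
    1 * suc k    ≡⟨ *-identityˡ (suc k) ⟩
    suc k        ∎) (n≮n (suc k))
    where open ≤-Reasoning
  a+k≤7 a@(suc (suc _)) zero 1+a<a _ = contradiction (begin-strict
    a            <⟨ n<1+n a ⟩
    suc a        <⟨ 1+a<a ⟩
    a * 1        ≡⟨ *-identityʳ a ⟩
    a            ∎) (n≮n a)
    where open ≤-Reasoning
  a+k≤7 (suc (suc a)) (suc k) _ 2x≤3y = begin
    suc (suc a) + suc k  ≡⟨ solve (a ∷ k ∷ []) ⟩
    3 + (a + k)          ≤⟨ +-monoʳ-≤ 3 (≤-trans (m≤m+n (a + k) (2 * a * k)) a+k+2ak≤4) ⟩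
    7                    ∎
    where
    open ≤-Reasoning
    a+k+2ak≤4 : a + k + 2 * a * k ≤ 4
    a+k+2ak≤4 = +-cancelˡ-≤ (3 * (4 + a + k)) _ _ (begin
      3 * (4 + a + k) + (a + k + 2 * a * k)          ≡⟨ solve (a ∷ k ∷ []) ⟩
      2 * (suc (suc a) * suc (suc k)) + 4            ≤⟨ +-monoˡ-≤ 4 2x≤3y ⟩
      3 * suc (suc k + suc (suc a)) + 4              ≡⟨ solve (a ∷ k ∷ []) ⟩
      3 * (4 + a + k) + 4                            ∎)

  solution? : ∀ m l k → Dec (Solution m l k)
  solution? m l k =
    triple? 1 5 2 ⊎-dec triple? 1 7 1 ⊎-dec triple? 1 7 5 ⊎-dec triple? 2 5 1
    ⊎-dec triple? 2 5 3 ⊎-dec triple? 4 4 1 ⊎-dec triple? 4 4 2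
    where
    triple? : ∀ m′ l′ k′ → Dec (m ≡ m′ × l ≡ l′ × k ≡ k′)
    triple? m′ l′ k′ = m ≟ m′ ×-dec l ≟ l′ ×-dec k ≟ k′

  KeyEquation : ℕ → ℕ → ℕ → Set
  KeyEquation m a k = (2 + m) * suc (k + a) ≡ a * suc k * suc m

  keyEquation? : ∀ m a k → Dec (KeyEquation m a k)
  keyEquation? m a k = (2 + m) * suc (k + a) ≟ a * suc k * suc m

  bounded-solutions : ∀ {m a k} → m < 7 → a < 8 → k < 8 →
                      KeyEquation (suc m) a k → Solution (suc m) (k + a) k
  bounded-solutions m<7 a<8 k<8 = toWitness {a? = search} _ m<7 a<8 k<8
    where
    Claim : ℕ → ℕ → ℕ → Set
    Claim m a k = KeyEquation (suc m) a k → Solution (suc m) (k + a) k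
    claim? : ∀ m a k → Dec (Claim m a k)
    claim? m a k = keyEquation? (suc m) a k →-dec solution? (suc m) (k + a) k
    search : Dec (∀ {m} → m < 7 → ∀ {a} → a < 8 → ∀ {k} → k < 8 → Claim m a k)
    search = allUpTo? (λ m → allUpTo? (λ a → allUpTo? (claim? m a) 8) 8) 7

  key-equation-solutions : ∀ {m a k} → 1 ≤ m → KeyEquation m a k → Solution m (k + a) k
  key-equation-solutions {suc m} {a} {k} 1≤m eq = bounded-solutions m<7 a<8 k<8 eq
    where
    open Proportion {x = a * suc k} {y = suc (k + a)} eq
    bound : a + k ≤ 7
    bound = a+k≤7 a k y<x (2x≤3y 1≤m)
    m<7 : m < 7
    m<7 = ≤-trans (s≤s⁻¹ 1+m≤y) (≤-trans (≤-reflexive (+-comm k a)) bound)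
    a<8 : a < 8
    a<8 = s≤s (≤-trans (m≤m+n a k) bound)
    k<8 : k < 8
    k<8 = s≤s (≤-trans (m≤n+m k a) bound)

  module _ {m l k : ℕ} (eq : (2 + m) * suc l + k * suc k * suc m ≡ l * suc k * suc m) where

    k<l : k < l
    k<l = ≰⇒> λ l≤k → n≮n (l * suc k * suc m) (begin-strict
      l * suc k * suc m                      ≤⟨ *-monoˡ-≤ (suc m) (*-monoˡ-≤ (suc k) l≤k) ⟩
      k * suc k * suc m                      <⟨ m<n+m (k * suc k * suc m) z<s ⟩
      (2 + m) * suc l + k * suc k * suc m    ≡⟨ eq ⟩
      l * suc k * suc m                      ∎)
      where open ≤-Reasoning

    cleared-solutions : 1 ≤ m → Solution m l k
    cleared-solutions 1≤m with a , refl ← m≤n⇒∃[o]m+o≡n (<⇒≤ k<l) =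
      key-equation-solutions 1≤m (+-cancelʳ-≡ (k * suc k * suc m) _ _ (begin
        (2 + m) * suc (k + a) + k * suc k * suc m  ≡⟨ eq ⟩
        (k + a) * suc k * suc m                    ≡⟨ solve (m ∷ a ∷ k ∷ []) ⟩
        a * suc k * suc m + k * suc k * suc m      ∎))
      where open ≡-Reasoning

open import Data.Rational using (1ℚ; _+_)

solution⇒equation : ∀ {m l k} → Solution m l k → 1ℚ + 1ℚ ≡ rhs m l k
solution⇒equation (inj₁ (refl , refl , refl)) = refl
solution⇒equation (inj₂ (inj₁ (refl , refl , refl))) = refl
solution⇒equation (inj₂ (inj₂ (inj₁ (refl , refl , refl)))) = refl
solution⇒equation (inj₂ (inj₂ (inj₂ (inj₁ (refl , refl , refl))))) = refl
solution⇒equation (inj₂ (inj₂ (inj₂ (inj₂ (inj₁ (refl , refl , refl)))))) = refl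
solution⇒equation (inj₂ (inj₂ (inj₂ (inj₂ (inj₂ (inj₁ (refl , refl , refl))))))) = refl
solution⇒equation (inj₂ (inj₂ (inj₂ (inj₂ (inj₂ (inj₂ (refl , refl , refl))))))) = refl

proposition2p11 : (m l k : ℕ) → m ≥ 1 → l ≥ 1 → k ≥ 1 →
    (1ℚ + 1ℚ ≡ rhs m l k
      → ((m ≡ 1 × l ≡ 5 × k ≡ 2) ⊎ (m ≡ 1 × l ≡ 7 × k ≡ 1) ⊎ (m ≡ 1 × l ≡ 7 × k ≡ 5)
        ⊎ (m ≡ 2 × l ≡ 5 × k ≡ 1) ⊎ (m ≡ 2 × l ≡ 5 × k ≡ 3) ⊎ (m ≡ 4 × l ≡ 4 × k ≡ 1)
        ⊎ (m ≡ 4 × l ≡ 4 × k ≡ 2)))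
    × (((m ≡ 1 × l ≡ 5 × k ≡ 2) ⊎ (m ≡ 1 × l ≡ 7 × k ≡ 1) ⊎ (m ≡ 1 × l ≡ 7 × k ≡ 5)
        ⊎ (m ≡ 2 × l ≡ 5 × k ≡ 1) ⊎ (m ≡ 2 × l ≡ 5 × k ≡ 3) ⊎ (m ≡ 4 × l ≡ 4 × k ≡ 1)
        ⊎ (m ≡ 4 × l ≡ 4 × k ≡ 2))
      → 1ℚ + 1ℚ ≡ rhs m l k)
proposition2p11 m l k m≥1 _ _ =
  (λ h → ClearedEquation.cleared-solutions (ClearDenominators.cleared m l k h) m≥1) ,
  solution⇒equation
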